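{- Let $\mathcal{A}$ be an $\mathrm{Inf}$-TELA, $w\in\Sigma^\omega$, and $G_w$ the run DAG of $\mathcal{A}$ over $w$. Then $w\notin\mathcal{L}(\mathcal{A})$ if and only if the labelling algorithm (described in the context) on $G_w$ terminates with a pair $(r,m)$.
   Context: TELA: $\mathcal{A}=(Q,\delta,I,\Gamma,p,\mathit{Acc})$ with finite states $Q$, $\delta\subseteq Q\times\Sigma\times Q$, initial states $I$, colours $\Gamma$, colouring $p:\delta\to2^\Gamma$, $\mathit{Acc}$ a $\wedge/\vee$-formula over $\mathit{true},\mathit{false},\mathrm{Inf}(c),\mathrm{Fin}(c)$; a run is accepting iff the set of colours on transitions occurring infinitely often satisfies $\mathit{Acc}$ ($\mathrm{Inf}(c)$: $c$ in the set; $\mathrm{Fin}(c)$: not); $\mathcal{L}(\mathcal{A})$: words with an accepting run from $I$. $\mathrm{Inf}$-TELA: no $\mathrm{Fin}$ atoms. $\overline{\mathit{Acc}}$: negation of $\mathit{Acc}$ in negation normal form with $\neg\mathrm{Inf}(c)$ written as variable $c$; $\mathrm{Min}$: the (assumed nonempty) set of $\subseteq$-minimal $M\subseteq\Gamma$ satisfying $\overline{\mathit{Acc}}$; $\mathrm{lex}$: its lexicographically smallest element. Run DAG $G_w=(V,E)$: $(q,i)\in V$ iff some run of $\mathcal{A}$ over $w$ from $I$ has $q$ at position $i$; $((q,i),(q',i'))\in E$ iff $i'=i+1$ and $(q,w_i,q')\in\delta$. For a DAG $G$ and vertex $v$, $\mathrm{reach}_G(v)$ is the set of vertices reachable from $v$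 (including $v$); $v$ is finite if $\mathrm{reach}_G(v)$ is finite. An edge $((q,i),(q',i+1))$ is a $c$-edge if $c\in p((q,w_i,q'))$; $v$ is $c$-endangered in $G$ if it reaches no $c$-edge in $G$, and $C$-endangered if $c$-endangered for all $c\in C$. $v_1,v_2$ converge if $\mathrm{reach}(v_1)\cap\mathrm{reach}(v_2)\ne\emptyset$. For $U\subseteq V$, $\eta:U\to\mathrm{Min}$ is endangered in $G$ if $\eta$ is finite and nonempty, each $v\in U$ is $\eta(v)$-endangered in $G$, and $\eta(v_1)=\eta(v_2)$ for all converging $v_1,v_2\in U$. Labelling algorithm (nondeterministic) on $G_w$: set $i:=0$, $r,m$ empty partial maps. Assign $r(v)=0$, $m(v)=\mathrm{lex}$ to every finite vertex $v$ of $G_w$, and let $G^0$ be $G_w$ without its finite vertices. While $G^i$ is nonempty: if there exist $U\subseteq V(G^i)$ and $\eta:U\to\mathrm{Min}$ endangered in $G^i$ (chosen nondeterministically), then for each $v\in U$ and $u\in\mathrm{reach}_{G^i}(v)$ set $r(u)=i+1$, $m(u)=\eta(v)$; let $G^{i+1}$ be $G^i$ without vertices of rank $i+1$; for each vertex $v$ finite in $G^{i+1}$ set $r(v)=i+2$, $m(v)=\mathrm{lex}$; let $G^{i+2}$ be $G^{i+1}$ without vertices of rank $i+2$; set $i:=i+2$. Otherwise return $\bot$. When the loop exits (because $G^i$ is empty), return $(r,m)$. -}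

module Defs where

open import Data.Nat using (ℕ; zero; suc; _≤_; _+_)
open import Data.Fin using (Fin)
open import Data.Bool using (Bool; true; false)
open import Data.Vec using (Vec; []; _∷_)
open import Data.Fin.Subset using (Subset; _∈_; _∉_; _⊆_)
open import Data.Product using (Σ; ∃; _×_; _,_)
open import Data.Sum using (_⊎_)
open import Data.Unit using (⊤)
open import Data.Empty using (⊥)
open import Data.List using (List; [])
open import Data.List.Membership.Propositional using () renaming (_∈_ to _∈ₗ_)
open import Relation.Nullary using (¬_)
open import Relation.Binary.PropositionalEquality using (_≡_; _≢_)

data Cond (k : ℕ) : Set where
  tt ff   : Cond k
  Inf Fn  : Fin k → Cond k
  _∧ᶜ_ _∨ᶜ_ : Cond k → Cond k → Cond k

Holds : ∀ {k} → Cond k → (Fin k → Set) → Set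
Holds tt        S = ⊤
Holds ff        S = ⊥
Holds (Inf c)   S = S c
Holds (Fn c)    S = ¬ S c
Holds (a ∧ᶜ b)  S = Holds a S × Holds b S
Holds (a ∨ᶜ b)  S = Holds a S ⊎ Holds b S

data InfOnly {k : ℕ} : Cond k → Set where
  tt  : InfOnly tt
  ff  : InfOnly ff
  inf : ∀ c → InfOnly (Inf c)
  and : ∀ {a b} → InfOnly a → InfOnly b → InfOnly (a ∧ᶜ b)
  or  : ∀ {a b} → InfOnly a → InfOnly b → InfOnly (a ∨ᶜ b)

data Pos (k : ℕ) : Set where
  ptt pff : Pos k
  var     : Fin k → Pos k
  _∧ᵖ_ _∨ᵖ_ : Pos k → Pos k → Pos k

PSat : ∀ {k} → Pos k → Subset k → Set
PSat ptt      M = ⊤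
PSat pff      M = ⊥
PSat (var c)  M = c ∈ M
PSat (a ∧ᵖ b) M = PSat a M × PSat b M
PSat (a ∨ᵖ b) M = PSat a M ⊎ PSat b M

-- negation of an Inf-only condition in NNF, with ¬Inf(c) written as variable c
overline : ∀ {k} (φ : Cond k) → InfOnly φ → Pos k
overline tt        _         = pff
overline ff        _         = ptt
overline (Inf c)   _         = var c
overline (a ∧ᶜ b)  (and x y) = overline a x ∨ᵖ overline b y
overline (a ∨ᶜ b)  (or x y)  = overline a x ∧ᵖ overline b y

-- lexicographic order on subsets as characteristic vectors, colour present
-- (true) before absent (false)
data _≤ˡ_ : ∀ {k} → Subset k → Subset k → Set where
  []≤  : [] ≤ˡ []
  same : ∀ {k b} {xs ys : Subset k} → xs ≤ˡ ys → (b ∷ xs) ≤ˡ (b ∷ ys)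
  lt   : ∀ {k} {xs ys : Subset k} → (true ∷ xs) ≤ˡ (false ∷ ys)

record TELA (n s k : ℕ) : Set where
  field
    δ   : Fin n → Fin s → Fin n → Bool
    I   : Subset n
    p   : Fin n → Fin s → Fin n → Subset k  -- colouring (relevant on δ)
    Acc : Cond k

module Lang {n s k} (A : TELA n s k) (w : ℕ → Fin s) where
  open TELA A

  IsRun : (ℕ → Fin n) → Set
  IsRun ρ = (ρ 0 ∈ I) × (∀ i → δ (ρ i) (w i) (ρ (suc i)) ≡ true)

  InfColours : (ℕ → Fin n) → Fin k → Set
  InfColours ρ c = Σ (Fin n) λ q → Σ (Fin s) λ a → Σ (Fin n) λ q' →
    (c ∈ p q a q') ×
    (∀ N → Σ ℕ λ i → (N ≤ i) × (ρ i ≡ q) × (w i ≡ a) × (ρ (suc i) ≡ q'))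

  Accepted : Set
  Accepted = Σ (ℕ → Fin n) λ ρ → IsRun ρ × Holds Acc (InfColours ρ)

module RunDAG {n s k} (A : TELA n s k) (h : InfOnly (TELA.Acc A)) (w : ℕ → Fin s) where
  open TELA A

  IsMin : Subset k → Set
  IsMin M = PSat (overline Acc h) M ×
            (∀ M' → M' ⊆ M → PSat (overline Acc h) M' → M' ≡ M)

  IsLex : Subset k → Set
  IsLex M = IsMin M × (∀ M' → IsMin M' → M ≤ˡ M')

  Vertex : Set
  Vertex = Fin n × ℕ

  data Reachable : ℕ → Fin n → Set where
    init : ∀ {q} → q ∈ I → Reachable 0 q
    next : ∀ {i q q'} → Reachable i q → δ q (w i) q' ≡ true → Reachable (suc i) q'

  -- subgraphs of G_w, given by their vertex sets (induced)
  Graph : Set₁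
  Graph = Vertex → Set

  Gw : Graph
  Gw (q , i) = Reachable i q

  data ReachG (G : Graph) : Vertex → Vertex → Set where
    here  : ∀ {v} → G v → ReachG G v v
    there : ∀ {q i q' v} → G (q , i) → G (q' , suc i) → δ q (w i) q' ≡ true →
            ReachG G (q' , suc i) v → ReachG G (q , i) v

  EdgeG : Graph → Fin n → ℕ → Fin n → Set
  EdgeG G q i q' = G (q , i) × G (q' , suc i) × (δ q (w i) q' ≡ true)

  FiniteIn : Graph → Vertex → Set
  FiniteIn G v = G v × Σ (List Vertex) λ L → ∀ u → ReachG G v u → u ∈ₗ L

  Endangered : Graph → Fin k → Vertex → Set
  Endangered G c v = ∀ q i q' → ReachG G v (q , i) → EdgeG G q i q' → c ∉ p q (w i) q'

  Converge : Graph → Vertex → Vertex → Set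
  Converge G v₁ v₂ = Σ Vertex λ u → ReachG G v₁ u × ReachG G v₂ u

  -- a finite map η : U → Min is given as a list of pairs with distinct keys
  data DistinctKeys : List (Vertex × Subset k) → Set where
    []  : DistinctKeys []
    _∷_ : ∀ {x M η} → (∀ M' → ¬ ((x , M') ∈ₗ η)) → DistinctKeys η →
          DistinctKeys (Data.List._∷_ (x , M) η)

  EndangeredMap : Graph → List (Vertex × Subset k) → Set
  EndangeredMap G η =
    DistinctKeys η × (η ≢ []) ×
    (∀ x M → (x , M) ∈ₗ η → G x × IsMin M × (∀ c → c ∈ M → Endangered G c x)) ×
    (∀ x₁ M₁ x₂ M₂ → (x₁ , M₁) ∈ₗ η → (x₂ , M₂) ∈ₗ η → Converge G x₁ x₂ → M₁ ≡ M₂)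

  removeReach : Graph → List (Vertex × Subset k) → Graph
  removeReach G η v = G v × ¬ (Σ Vertex λ x → Σ (Subset k) λ M → ((x , M) ∈ₗ η) × ReachG G x v)

  removeFinite : Graph → Graph
  removeFinite G v = G v × ¬ FiniteIn G v

  -- Exec r m i G: a (finite) execution of the loop, starting with i and G^i = G,
  -- that exits with the final rank map r and mark map m (restricted to vertices of G_w)
  data Exec (r : Vertex → ℕ) (m : Vertex → Subset k) : ℕ → Graph → Set₁ where
    done : ∀ {i G} → (∀ v → ¬ G v) → Exec r m i G
    step : ∀ {i G} (η : List (Vertex × Subset k)) → EndangeredMap G η →
           (∀ x M u → (x , M) ∈ₗ η → ReachG G x u → (r u ≡ suc i) × (m u ≡ M)) →
           (∀ u → FiniteIn (removeReach G η) u → (r u ≡ suc (suc i)) × IsLex (m u)) →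
           Exec r m (suc (suc i)) (removeFinite (removeReach G η)) →
           Exec r m i G

  Returns : (Vertex → ℕ) → (Vertex → Subset k) → Set₁
  Returns r m = (∀ v → FiniteIn Gw v → (r v ≡ 0) × IsLex (m v)) ×
                Exec r m 0 (removeFinite Gw)

-- An accepting run ρ cannot survive a terminating execution. Its vertices are not finite, so it
-- starts in G⁰; when a round removes reach(x) for an M-endangered x, either ρ has entered
-- reach(x), and then avoids every colour of M from there on although M satisfies the negated
-- acceptance condition, or its tail survives into the next graph.
-- Conversely, let w be rejected. Every nonempty Gⁱ has a vertex endangered for some Min set:
-- otherwise a run that reaches Gⁱ and then keeps heading for the next edge coloured by a Min set,
-- cycling through all of them, meets every Min set infinitely often and is therefore accepting.
-- Since Gⁱ has no dead ends, the reach of such a vertex contains a state of every later level, so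
-- removing it lowers the number of states on all late levels and the graph is empty after at
-- most |Q| rounds. Each vertex gets the rank and mark of the round in which it leaves.

module Submission where

open import Defs
open import Level using (0ℓ)
open import Axiom.ExcludedMiddle using (ExcludedMiddle)
open import Function.Base using (_∘_)
open import Data.Nat using (ℕ; zero; suc; _≤_; _+_; _*_; _∸_; _⊔_; z≤n; _≤′_; ≤′-refl; ≤′-step)
open import Data.Nat.Properties
open import Data.Nat.DivMod using (_mod_; _%_; [m+kn]%n≡m%n; m<n⇒m%n≡m)
open import Data.Fin using (Fin; zero; suc; toℕ)
open import Data.Fin.Properties using (toℕ-injective; toℕ-fromℕ<; toℕ<n)
open import Data.Bool using (true; false)
open import Data.Vec using ([]; _∷_)
import Data.Vec as Vec
open import Data.Fin.Subset using (Subset; _∈_; _⊆_; ∣_∣; _-_; ⊤)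
open import Data.Fin.Subset.Properties using (drop-∷-⊆; ∣p∣≤n; ∈⊤; x∈p⇒∣p-x∣<∣p∣; x∈p∧x≢y⇒x∈p-y)
open import Data.List using (List; []; _∷_; _++_; map; length; lookup; filter; concatMap; allFin)
import Data.List.Relation.Unary.All as All
open import Data.List.Extrema.Nat using (max; xs≤max)
open import Data.List.Membership.Propositional using (lose) renaming (_∈_ to _∈ₗ_)
open import Data.List.Membership.Propositional.Properties
  using (∈-++⁺ˡ; ∈-++⁺ʳ; ∈-map⁺; ∈-lookup; ∈-filter⁺; ∈-filter⁻; ∈-concatMap⁺; ∈-allFin)
open import Data.List.Relation.Unary.Any using (here; there; index)
open import Data.List.Relation.Unary.Any.Properties using (lookup-index)
open import Data.Product using (Σ; _×_; _,_; proj₁; proj₂)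
open import Data.Sum using (inj₁; inj₂)
open import Data.Unit using (tt)
open import Relation.Nullary using (¬_; Dec; yes; no; contradiction)
open import Relation.Nullary.Decidable using (isNo)
open import Relation.Binary.Definitions using (tri<; tri≈; tri>)
open import Function.Bundles using (_⇔_; mk⇔)
open import Relation.Binary.PropositionalEquality
  using (_≡_; refl; cong; sym; trans; subst; subst₂; module ≡-Reasoning)

InfinitelyOften : (ℕ → Set) → Set
InfinitelyOften P = ∀ N → Σ ℕ λ j → N ≤ j × P j

subsets : ∀ k → List (Subset k)
subsets zero    = [] ∷ []
subsets (suc k) = map (true ∷_) (subsets k) ++ map (false ∷_) (subsets k)

∈-subsets : ∀ {k} (M : Subset k) → M ∈ₗ subsets k
∈-subsets []          = here refl
∈-subsets (true ∷ M)  = ∈-++⁺ˡ (∈-map⁺ (true ∷_) (∈-subsets M))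
∈-subsets (false ∷ M) = ∈-++⁺ʳ _ (∈-map⁺ (false ∷_) (∈-subsets M))

cyclic : ∀ {A : Set} → A → List A → ℕ → A
cyclic x xs t = lookup (x ∷ xs) (t mod suc (length xs))

cyclic-∈ : ∀ {A : Set} (x : A) xs t → cyclic x xs t ∈ₗ x ∷ xs
cyclic-∈ x xs t = ∈-lookup (t mod suc (length xs))

cyclic-recurrent : ∀ {A : Set} {x y : A} {xs} → y ∈ₗ x ∷ xs →
                   InfinitelyOften (λ t → cyclic x xs t ≡ y)
cyclic-recurrent {x = x} {y} {xs} y∈ N =
  t , ≤-trans (m≤m*n N L) (m≤n+m (N * L) (toℕ i)) , sym (trans (lookup-index y∈) (cong (lookup (x ∷ xs)) i≡t-mod))
  where
    L = suc (length xs)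
    i = index y∈
    t = toℕ i + N * L
    i≡t-mod : i ≡ t mod L
    i≡t-mod = toℕ-injective (sym (begin
      toℕ (t mod L)   ≡⟨ toℕ-fromℕ< _ ⟩
      t % L           ≡⟨ [m+kn]%n≡m%n (toℕ i) N L ⟩
      toℕ i % L       ≡⟨ m<n⇒m%n≡m (toℕ<n i) ⟩
      toℕ i           ∎))
      where open ≡-Reasoning

holds∧overline⇒meets : ∀ {k} {φ : Cond k} (φ-inf : InfOnly φ) {S : Fin k → Set} {M} →
                       Holds φ S → PSat (overline φ φ-inf) M → ¬ (∀ c → c ∈ M → ¬ S c)
holds∧overline⇒meets (inf c)   Sc        c∈M       disjoint = disjoint c c∈M Sc
holds∧overline⇒meets (and a b) (Sa , _)  (inj₁ Ma) disjoint = holds∧overline⇒meets a Sa Ma disjoint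
holds∧overline⇒meets (and a b) (_ , Sb)  (inj₂ Mb) disjoint = holds∧overline⇒meets b Sb Mb disjoint
holds∧overline⇒meets (or a b)  (inj₁ Sa) (Ma , _)  disjoint = holds∧overline⇒meets a Sa Ma disjoint
holds∧overline⇒meets (or a b)  (inj₂ Sb) (_ , Mb)  disjoint = holds∧overline⇒meets b Sb Mb disjoint

module _ (em : ExcludedMiddle 0ℓ) where

  lex-least : ∀ {k} (P : Subset k → Set) → Σ (Subset k) P →
              Σ (Subset k) λ M → P M × (∀ M' → P M' → M ≤ˡ M')
  lex-least {zero} P ([] , P[]) = [] , P[] , λ { [] _ → []≤ }
  lex-least {suc k} P (b ∷ M₀ , PM₀) with em {Σ (Subset k) (P ∘ (true ∷_))} | b
  ... | yes withTrue | _ =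
    let (M , PM , least) = lex-least (P ∘ (true ∷_)) withTrue in
    true ∷ M , PM , λ { (true ∷ M') PM' → same (least M' PM') ; (false ∷ M') _ → lt }
  ... | no noTrue | true = contradiction (M₀ , PM₀) noTrue
  ... | no noTrue | false =
    let (M , PM , least) = lex-least (P ∘ (false ∷_)) (M₀ , PM₀) in
    false ∷ M , PM , λ { (true ∷ M') PM' → contradiction (M' , PM') noTrue
                       ; (false ∷ M') PM' → same (least M' PM') }

  ⊆-minimal : ∀ {k} (P : Subset k → Set) → Σ (Subset k) P →
              Σ (Subset k) λ M → P M × (∀ M' → M' ⊆ M → P M' → M' ≡ M)
  ⊆-minimal {zero} P ([] , P[]) = [] , P[] , λ { [] _ _ → refl }
  ⊆-minimal {suc k} P (b ∷ M₀ , PM₀) with em {Σ (Subset k) (P ∘ (false ∷_))} | b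
  ... | yes withFalse | _ =
    let (M , PM , minimal) = ⊆-minimal (P ∘ (false ∷_)) withFalse in
    false ∷ M , PM , λ { (true ∷ M') M'⊆ _ → contradiction (M'⊆ Vec.here) λ ()
                       ; (false ∷ M') M'⊆ PM' → cong (false ∷_) (minimal M' (drop-∷-⊆ M'⊆) PM') }
  ... | no noFalse | false = contradiction (M₀ , PM₀) noFalse
  ... | no noFalse | true =
    let (M , PM , minimal) = ⊆-minimal (P ∘ (true ∷_)) (M₀ , PM₀) in
    true ∷ M , PM , λ { (true ∷ M') M'⊆ PM' → cong (true ∷_) (minimal M' (drop-∷-⊆ M'⊆) PM')
                      ; (false ∷ M') _ PM' → contradiction (M' , PM') noFalse }

  pigeonhole : ∀ m (P : Fin m → ℕ → Set) → InfinitelyOften (λ j → Σ (Fin m) λ x → P x j) →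
               Σ (Fin m) λ x → InfinitelyOften (P x)
  pigeonhole zero P io with io 0
  ... | _ , _ , () , _
  pigeonhole (suc m) P io with em {Σ ℕ λ N₀ → ∀ j → N₀ ≤ j → ¬ P zero j}
  ... | no unbounded = zero , recurs
    where
      recurs : InfinitelyOften (P zero)
      recurs N with em {Σ ℕ λ j → N ≤ j × P zero j}
      ... | yes found = found
      ... | no none = contradiction (N , λ j N≤j Pj → none (j , N≤j , Pj)) unbounded
  ... | yes (N₀ , bounded) =
    let (x , recurs) = pigeonhole m (P ∘ suc) ioSuc in suc x , recurs
    where
      ioSuc : InfinitelyOften (λ j → Σ (Fin m) λ x → P (suc x) j)
      ioSuc N with io (N ⊔ N₀)
      ... | j , le , zero , Pj = contradiction Pj (bounded j (≤-trans (m≤n⊔m N N₀) le))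
      ... | j , le , suc x , Pj = j , ≤-trans (m≤m⊔n N N₀) le , x , Pj

  recurring-value : ∀ {m} (f : ℕ → Fin m) {P : ℕ → Set} → InfinitelyOften P →
                    Σ (Fin m) λ x → InfinitelyOften (λ j → f j ≡ x × P j)
  recurring-value f {P} io =
    pigeonhole _ (λ x j → f j ≡ x × P j) λ N → let (j , N≤j , Pj) = io N in j , N≤j , f j , refl , Pj

  complement : ∀ {k} → (Fin k → Set) → Subset k
  complement {zero}  S = []
  complement {suc k} S = isNo (em {S zero}) ∷ complement (S ∘ suc)

  ∉⇒∈-complement : ∀ {k} (S : Fin k → Set) {c} → ¬ S c → c ∈ complement S
  ∉⇒∈-complement S {zero} ¬Sc with em {S zero}
  ... | yes Sc = contradiction Sc ¬Sc
  ... | no _   = Vec.here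
  ∉⇒∈-complement S {suc c} ¬Sc = Vec.there (∉⇒∈-complement (S ∘ suc) ¬Sc)

  ∈-complement⇒∉ : ∀ {k} (S : Fin k → Set) {c} → c ∈ complement S → ¬ S c
  ∈-complement⇒∉ S {zero} c∈ with em {S zero}
  ∈-complement⇒∉ S {zero} () | yes _
  ... | no ¬Sc = ¬Sc
  ∈-complement⇒∉ S {suc c} (Vec.there c∈) = ∈-complement⇒∉ (S ∘ suc) c∈

  ¬holds⇒overline : ∀ {k} {φ : Cond k} (φ-inf : InfOnly φ) {S : Fin k → Set} {X} →
                    (∀ c → ¬ S c → c ∈ X) → ¬ Holds φ S → PSat (overline φ φ-inf) X
  ¬holds⇒overline tt        _   ¬holds = ¬holds tt
  ¬holds⇒overline ff        _   _      = tt
  ¬holds⇒overline (inf c)   ⊆X  ¬holds = ⊆X c ¬holds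
  ¬holds⇒overline (and {a} a-inf b-inf) {S} ⊆X ¬holds with em {Holds a S}
  ... | yes Sa = inj₂ (¬holds⇒overline b-inf ⊆X λ Sb → ¬holds (Sa , Sb))
  ... | no ¬Sa = inj₁ (¬holds⇒overline a-inf ⊆X ¬Sa)
  ¬holds⇒overline (or a-inf b-inf) ⊆X ¬holds =
    ¬holds⇒overline a-inf ⊆X (¬holds ∘ inj₁) , ¬holds⇒overline b-inf ⊆X (¬holds ∘ inj₂)

module Labelling (em : ExcludedMiddle 0ℓ) {n s k} (A : TELA n s k) (h : InfOnly (TELA.Acc A))
                 (w : ℕ → Fin s) where
  open TELA A
  open Lang A w
  open RunDAG A h w

  colour-transport : ∀ {col q a q' x b y} → q ≡ x → a ≡ b → q' ≡ y → col ∈ p q a q' → col ∈ p x b y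
  colour-transport refl refl refl col∈ = col∈

  rejecting⇒disjoint-min : ∀ {S} → ¬ Holds Acc S → Σ (Subset k) λ M → IsMin M × (∀ c → c ∈ M → ¬ S c)
  rejecting⇒disjoint-min {S} ¬holds =
    let (M , (PM , M⊆) , minimal) = ⊆-minimal em (λ M → PSat (overline Acc h) M × M ⊆ complement em S)
          (complement em S , ¬holds⇒overline em h (λ _ → ∉⇒∈-complement em S) ¬holds , λ c∈ → c∈)
    in M , (PM , λ M' M'⊆M PM' → minimal M' M'⊆M (PM' , M⊆ ∘ M'⊆M)) , λ _ c∈M → ∈-complement⇒∉ em S (M⊆ c∈M)

  meets-every-min⇒holds : ∀ {S} → (∀ M → IsMin M → Σ (Fin k) λ c → c ∈ M × S c) → Holds Acc S
  meets-every-min⇒holds {S} meets with em {Holds Acc S}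
  ... | yes holds = holds
  ... | no ¬holds =
    let (M , M-min , disjoint) = rejecting⇒disjoint-min ¬holds
        (c , c∈M , Sc) = meets M M-min
    in contradiction Sc (disjoint c c∈M)

  minTarget : Subset k → ℕ → Subset k
  minTarget M₀ = cyclic M₀ (filter (λ M → em {IsMin M}) (subsets k))

  minTarget-min : ∀ {M₀} → IsMin M₀ → ∀ t → IsMin (minTarget M₀ t)
  minTarget-min {M₀} M₀-min t with cyclic-∈ M₀ (filter (λ M → em {IsMin M}) (subsets k)) t
  ... | here eq   = subst IsMin (sym eq) M₀-min
  ... | there mem = proj₂ (∈-filter⁻ (λ M → em {IsMin M}) {xs = subsets k} mem)

  minTarget-recurrent : ∀ {M₀ M} → IsMin M → InfinitelyOften (λ t → minTarget M₀ t ≡ M)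
  minTarget-recurrent {M = M} M-min =
    cyclic-recurrent (there (∈-filter⁺ (λ M → em {IsMin M}) (∈-subsets M) M-min))

  -- Paths in subgraphs of the run DAG

  HasSuccessors : Graph → Set
  HasSuccessors G = ∀ q i → G (q , i) → Σ (Fin n) λ q' → G (q' , suc i) × δ q (w i) q' ≡ true

  StaysIn : Graph → (ℕ → Fin n) → ℕ → Set
  StaysIn G ρ j = ∀ i → j ≤ i → G (ρ i , i)

  reach-target : ∀ {G u v} → ReachG G u v → G v
  reach-target (here Gv)          = Gv
  reach-target (there _ _ _ path) = reach-target path

  reach-snoc : ∀ {G u q i q'} → ReachG G u (q , i) → G (q' , suc i) → δ q (w i) q' ≡ true →
               ReachG G u (q' , suc i)
  reach-snoc (here Gq)               Gq' move = there Gq Gq' move (here Gq')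
  reach-snoc (there Gu Gv move path) Gq' move' = there Gu Gv move (reach-snoc path Gq' move')

  reach-trans : ∀ {G u v x} → ReachG G u v → ReachG G v x → ReachG G u x
  reach-trans (here _)                path' = path'
  reach-trans (there Gu Gv move path) path' = there Gu Gv move (reach-trans path path')

  reach-level : ∀ {G q i j} → HasSuccessors G → G (q , i) → i ≤ j → Σ (Fin n) λ q' → ReachG G (q , i) (q' , j)
  reach-level {G} {q} {i} succ Gq i≤j = go (≤⇒≤′ i≤j)
    where
      go : ∀ {j} → i ≤′ j → Σ (Fin n) λ q' → ReachG G (q , i) (q' , j)
      go ≤′-refl          = q , here Gq
      go (≤′-step i≤′j) =
        let (q' , path) = go i≤′j
            (q'' , Gq'' , move) = succ q' _ (reach-target path)
        in q'' , reach-snoc path Gq'' move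

  run-path : ∀ {G ρ j i} → IsRun ρ → StaysIn G ρ j → j ≤ i → ReachG G (ρ j , j) (ρ i , i)
  run-path {G} {ρ} {j} run stays j≤i = go (≤⇒≤′ j≤i)
    where
      go : ∀ {i} → j ≤′ i → ReachG G (ρ j , j) (ρ i , i)
      go ≤′-refl          = here (stays j ≤-refl)
      go (≤′-step j≤′i) = reach-snoc (go j≤′i) (stays _ (≤′⇒≤ (≤′-step j≤′i))) (proj₂ run _)

  run-infinite : ∀ {G ρ j} → IsRun ρ → StaysIn G ρ j → ¬ FiniteIn G (ρ j , j)
  run-infinite {ρ = ρ} {j} run stays (_ , L , finite) =
    1+n≰n (≤-trans (m≤m+n (suc bound) j) (All.lookup (xs≤max 0 (map proj₂ L)) (∈-map⁺ proj₂ reached)))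
    where
      bound = max 0 (map proj₂ L)
      reached = finite _ (run-path run stays (m≤n+m j (suc bound)))

  staysIn-later : ∀ {G ρ j i} → StaysIn G ρ j → j ≤ i → StaysIn G ρ i
  staysIn-later stays j≤i i' i≤i' = stays i' (≤-trans j≤i i≤i')

  staysIn-removeFinite : ∀ {G ρ j} → IsRun ρ → StaysIn G ρ j → StaysIn (removeFinite G) ρ j
  staysIn-removeFinite {G} run stays i j≤i = stays i j≤i , run-infinite {G} run (staysIn-later {G} stays j≤i)

  removeFinite-successors : ∀ G → HasSuccessors (removeFinite G)
  removeFinite-successors G q i (Gq , infinite)
    with em {Σ (Fin n) λ q' → removeFinite G (q' , suc i) × δ q (w i) q' ≡ true}
  ... | yes successor = successor
  ... | no none = contradiction (Gq , (q , i) ∷ concatMap reachList (allFin n) , covers) infinite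
    where
      reachList : Fin n → List Vertex
      reachList q' with em {FiniteIn G (q' , suc i)}
      ... | yes (_ , L , _) = L
      ... | no _            = []

      ∈-reachList : ∀ {q' u} → G (q' , suc i) → δ q (w i) q' ≡ true → ReachG G (q' , suc i) u → u ∈ₗ reachList q'
      ∈-reachList {q'} Gq' move path with em {FiniteIn G (q' , suc i)}
      ... | yes (_ , _ , finite) = finite _ path
      ... | no infinite'         = contradiction (q' , (Gq' , infinite') , move) none

      covers : ∀ u → ReachG G (q , i) u → u ∈ₗ (q , i) ∷ concatMap reachList (allFin n)
      covers _ (here _)                  = here refl
      covers _ (there {q' = q'} _ Gq' move path) =
        there (∈-concatMap⁺ reachList (lose (∈-allFin q') (∈-reachList Gq' move path)))

  run-through : ∀ {i q} → Reachable i q → (g : ℕ → Fin n) → g 0 ≡ q →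
                (∀ d → δ (g d) (w (d + i)) (g (suc d)) ≡ true) →
                Σ (ℕ → Fin n) λ ρ → IsRun ρ × (∀ d → ρ (d + i) ≡ g d)
  run-through (init q∈I) g refl moves =
    g , (q∈I , λ j → subst (λ j' → δ (g j) (w j') (g (suc j)) ≡ true) (+-identityʳ j) (moves j)) ,
    λ d → cong g (+-identityʳ d)
  run-through (next {i} {q} reachable move) g g0≡q' moves =
    let (ρ , run , agrees) = run-through reachable (q ◂ g) refl moves'
    in ρ , run , λ d → trans (cong ρ (+-suc d i)) (agrees (suc d))
    where
      _◂_ : Fin n → (ℕ → Fin n) → ℕ → Fin n
      (x ◂ f) zero    = x
      (x ◂ f) (suc d) = f d

      moves' : ∀ d → δ ((q ◂ g) d) (w (d + i)) ((q ◂ g) (suc d)) ≡ true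
      moves' zero    = subst (λ q' → δ q (w i) q' ≡ true) (sym g0≡q') move
      moves' (suc d) = subst (λ j → δ (g d) (w j) (g (suc d)) ≡ true) (+-suc d i) (moves d)

  -- Runs meeting every Min set

  record Hit (G : Graph) (M : Subset k) (x : Vertex) : Set where
    constructor hit
    field
      {src tgt} : Fin n
      {pos}     : ℕ
      path      : ReachG G x (src , pos)
      edge      : EdgeG G src pos tgt
      colour    : Σ (Fin k) λ c → c ∈ M × c ∈ p src (w pos) tgt

  ¬hit⇒endangered : ∀ {G M x} → ¬ Hit G M x → ∀ c → c ∈ M → Endangered G c x
  ¬hit⇒endangered ¬hit c c∈M _ _ _ path edge c∈p = ¬hit (hit path edge (c , c∈M , c∈p))

  -- The run is cut into segments: segment t follows the path of a Hit to an edge coloured by target t.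
  module RecurrentRun (G : Graph) (target : ℕ → Subset k) (hits : ∀ t x → G x → Hit G (target t) x)
                      {q₀ i₀} (Gx₀ : G (q₀ , i₀)) where

    record Cursor : Set where
      constructor cursor
      field
        segment : ℕ
        vertex  : Vertex
        goal    : Hit G (target segment) vertex
    open Cursor

    advance : Cursor → Cursor
    advance (cursor t _ (hit (here _) (_ , Gtgt , _) _)) = cursor (suc t) _ (hits (suc t) _ Gtgt)
    advance (cursor t _ (hit (there _ _ _ path) edge colour)) = cursor t _ (hit path edge colour)

    state : Cursor → Fin n
    state = proj₁ ∘ vertex

    level : Cursor → ℕ
    level = proj₂ ∘ vertex

    level-advance : ∀ c → level (advance c) ≡ suc (level c)
    level-advance (cursor _ _ (hit (here _) _ _))          = refl
    level-advance (cursor _ _ (hit (there _ _ _ _) _ _)) = refl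

    advance-move : ∀ c → δ (state c) (w (level c)) (state (advance c)) ≡ true
    advance-move (cursor _ _ (hit (here _) (_ , _ , move) _))  = move
    advance-move (cursor _ _ (hit (there _ _ move _) _ _)) = move

    Crosses : Cursor → Set
    Crosses c = segment (advance c) ≡ suc (segment c) ×
                Σ (Fin k) λ col → col ∈ target (segment c) × col ∈ p (state c) (w (level c)) (state (advance c))

    advance^ : ℕ → Cursor → Cursor
    advance^ zero    c = c
    advance^ (suc d) c = advance^ d (advance c)

    advance^-+ : ∀ a b c → advance^ (a + b) c ≡ advance^ b (advance^ a c)
    advance^-+ zero    b c = refl
    advance^-+ (suc a) b c = advance^-+ a b (advance c)

    advance^-suc : ∀ d c → advance^ (suc d) c ≡ advance (advance^ d c)
    advance^-suc d c = trans (cong (λ e → advance^ e c) (+-comm 1 d)) (advance^-+ d 1 c)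

    level-advance^ : ∀ d c → level (advance^ d c) ≡ d + level c
    level-advance^ zero    c = refl
    level-advance^ (suc d) c =
      trans (level-advance^ d (advance c)) (trans (cong (d +_) (level-advance c)) (+-suc d (level c)))

    eventually-crosses : ∀ c → Σ ℕ λ d → segment (advance^ d c) ≡ segment c × Crosses (advance^ d c)
    eventually-crosses (cursor t _ (hit path edge colour)) = along path
      where
        along : ∀ {x} (path : ReachG G x _) → let c = cursor t x (hit path edge colour) in
                Σ ℕ λ d → segment (advance^ d c) ≡ t × Crosses (advance^ d c)
        along (here _)            = 0 , refl , refl , colour
        along (there _ _ _ path) = let (d , same-segment , crosses) = along path in suc d , same-segment , crosses

    crosses-later-segment : ∀ e c → Σ ℕ λ d → segment (advance^ d c) ≡ e + segment c × Crosses (advance^ d c)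
    crosses-later-segment zero    c = eventually-crosses c
    crosses-later-segment (suc e) c =
      let (d , segment-d , next-segment , _) = crosses-later-segment e c
          c' = advance^ (suc d) c
          (d' , segment-d' , crosses) = eventually-crosses c'
          segment-c' : segment c' ≡ suc e + segment c
          segment-c' = trans (cong segment (advance^-suc d c)) (trans next-segment (cong suc segment-d))
      in suc d + d' ,
         subst (λ c'' → segment c'' ≡ suc e + segment c × Crosses c'') (sym (advance^-+ (suc d) d' c))
               (trans segment-d' segment-c' , crosses)

    crosses-segment-after : ∀ c N t → segment (advance^ N c) ≤ t →
                            Σ ℕ λ d → N ≤ d × segment (advance^ d c) ≡ t × Crosses (advance^ d c)
    crosses-segment-after c N t later =
      let c' = advance^ N c
          (d , segment-d , crosses) = crosses-later-segment (t ∸ segment c') c'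
      in N + d , m≤m+n N d ,
         subst (λ c'' → segment c'' ≡ t × Crosses c'') (sym (advance^-+ N d c))
               (trans segment-d (m∸n+n≡m later) , crosses)

    c₀ : Cursor
    c₀ = cursor 0 (q₀ , i₀) (hits 0 _ Gx₀)

    trace : ℕ → Fin n
    trace d = state (advance^ d c₀)

    trace-moves : ∀ d → δ (trace d) (w (d + i₀)) (trace (suc d)) ≡ true
    trace-moves d =
      subst₂ (λ j q' → δ (trace d) (w j) q' ≡ true) (level-advance^ d c₀) (cong state (sym (advance^-suc d c₀)))
             (advance-move (advance^ d c₀))

    crossings : ∀ {ρ : ℕ → Fin n} → (∀ d → ρ (d + i₀) ≡ trace d) → ∀ M → InfinitelyOften (λ t → target t ≡ M) →
                InfinitelyOften (λ j → Σ (Fin k) λ c → c ∈ M × c ∈ p (ρ j) (w j) (ρ (suc j)))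
    crossings {ρ} agrees M recurrent N =
      let (t , later , target-t) = recurrent (segment (advance^ N c₀))
          (d , N≤d , segment-d , _ , c , c∈ , c∈p) = crosses-segment-after c₀ N t later
      in d + i₀ , ≤-trans N≤d (m≤m+n d i₀) , c ,
         subst (c ∈_) (trans (cong target segment-d) target-t) c∈ ,
         colour-transport (sym (agrees d)) (cong w (level-advance^ d c₀))
                          (trans (cong state (sym (advance^-suc d c₀))) (sym (agrees (suc d)))) c∈p

    recurrent-run : Reachable i₀ q₀ →
                    Σ (ℕ → Fin n) λ ρ → IsRun ρ × (∀ M → InfinitelyOften (λ t → target t ≡ M) →
                      InfinitelyOften (λ j → Σ (Fin k) λ c → c ∈ M × c ∈ p (ρ j) (w j) (ρ (suc j))))
    recurrent-run reachable with run-through reachable trace refl trace-moves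
    ... | ρ , run , agrees = ρ , run , crossings agrees

  recurring-colour : ∀ ρ M → InfinitelyOften (λ j → Σ (Fin k) λ c → c ∈ M × c ∈ p (ρ j) (w j) (ρ (suc j))) →
                     Σ (Fin k) λ c → c ∈ M × InfColours ρ c
  recurring-colour ρ M io with recurring-value em ρ io
  ... | q , io₁ with recurring-value em w io₁
  ... | a , io₂ with recurring-value em (ρ ∘ suc) io₂
  ... | q' , io₃ with io₃ 0
  ... | _ , _ , e₃ , e₂ , e₁ , c , c∈M , c∈p =
    c , c∈M , q , a , q' , colour-transport e₁ e₂ e₃ c∈p ,
    λ N → let (j , N≤j , e₃ , e₂ , e₁ , _) = io₃ N in j , N≤j , e₁ , e₂ , e₃

  EndangeredVertex : Graph → Set
  EndangeredVertex G = Σ Vertex λ x → Σ (Subset k) λ M → G x × IsMin M × (∀ c → c ∈ M → Endangered G c x)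

  ∃-endangered : ¬ Accepted → Σ (Subset k) IsMin → (G : Graph) → (∀ v → G v → Gw v) →
                 ∀ {x} → G x → EndangeredVertex G
  ∃-endangered rejecting (M₀ , M₀-min) G G⊆Gw Gx with em {EndangeredVertex G}
  ... | yes endangered = endangered
  ... | no none with RecurrentRun.recurrent-run G (minTarget M₀) hits Gx (G⊆Gw _ Gx)
    where
      hits : ∀ t x → G x → Hit G (minTarget M₀ t) x
      hits t x Gx with em {Hit G (minTarget M₀ t) x}
      ... | yes found = found
      ... | no ¬hit = contradiction (x , _ , Gx , minTarget-min M₀-min t , ¬hit⇒endangered ¬hit) none
  ... | ρ , run , crossings =
    contradiction (ρ , run , meets-every-min⇒holds λ M M-min →
                             recurring-colour ρ M (crossings M (minTarget-recurrent M-min)))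
                  rejecting

  -- Termination excludes acceptance

  endangered⇒finitely-coloured : ∀ {G ρ j x c} → IsRun ρ → StaysIn G ρ j → ReachG G x (ρ j , j) →
                                 Endangered G c x → ¬ InfColours ρ c
  endangered⇒finitely-coloured {ρ = ρ} {j} run stays reaches endangered (_ , _ , _ , c∈p , recurs)
    with recurs j
  ... | i , j≤i , e₁ , e₂ , e₃ =
    endangered (ρ i) i (ρ (suc i)) (reach-trans reaches (run-path run stays j≤i))
               (stays i j≤i , stays (suc i) (m≤n⇒m≤1+n j≤i) , proj₂ run i)
               (colour-transport (sym e₁) (sym e₂) (sym e₃) c∈p)

  exec-excludes-accepting-run : ∀ {r m i G ρ j} → IsRun ρ → Holds Acc (InfColours ρ) → Exec r m i G →
                                ¬ StaysIn G ρ j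
  exec-excludes-accepting-run {j = j} run holds (done empty) stays = empty _ (stays j ≤-refl)
  exec-excludes-accepting-run {G = G} {ρ} {j} run holds (step η (_ , _ , endangered , _) _ _ exec) stays
    with em {Σ ℕ λ i → j ≤ i × Σ Vertex λ x → Σ (Subset k) λ M → (x , M) ∈ₗ η × ReachG G x (ρ i , i)}
  ... | yes (i , j≤i , x , M , x∈η , reaches) =
    let (_ , M-min , M-endangered) = endangered x M x∈η in
    holds∧overline⇒meets h holds (proj₁ M-min) λ c c∈M →
      endangered⇒finitely-coloured run (staysIn-later {G} stays j≤i) reaches (M-endangered c c∈M)
  ... | no unreached =
    exec-excludes-accepting-run run holds exec (staysIn-removeFinite {removeReach G η} run staysRemoved)
    where
      staysRemoved : StaysIn (removeReach G η) ρ j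
      staysRemoved i j≤i = stays i j≤i , λ (x , M , x∈η , reaches) → unreached (i , j≤i , x , M , x∈η , reaches)

  returns⇒rejecting : ∀ {r m} → Returns r m → ¬ Accepted
  returns⇒rejecting (_ , exec) (ρ , run , holds) =
    exec-excludes-accepting-run {j = 0} run holds exec (staysIn-removeFinite {Gw} run λ i _ → reachable i)
    where
      reachable : ∀ i → Gw (ρ i , i)
      reachable zero    = init (proj₁ run)
      reachable (suc i) = next (reachable i) (proj₂ run i)

  -- Rejection yields a terminating execution

  -- One endangered vertex per round suffices, so every round removes the reach of a single vertex.
  choice : ∀ {G} → Dec (EndangeredVertex G) → List (Vertex × Subset k)
  choice (yes (x , M , _)) = (x , M) ∷ []
  choice (no _)            = []

  choice-endangered : ∀ {G} → EndangeredVertex G → (d : Dec (EndangeredVertex G)) → EndangeredMap G (choice d)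
  choice-endangered e (no none)                = contradiction e none
  choice-endangered _ (yes (x , M , endangered)) =
    ((λ _ ()) ∷ []) , (λ ()) , (λ { _ _ (here refl) → endangered }) , λ { _ _ _ _ (here refl) (here refl) _ → refl }

  choice-functional : ∀ {G x M x' M'} (d : Dec (EndangeredVertex G)) →
                      (x , M) ∈ₗ choice d → (x' , M') ∈ₗ choice d → M ≡ M'
  choice-functional (yes _) (here refl) (here refl) = refl

  LevelBound : ℕ → Graph → ℕ → Set
  LevelBound K G L = ∀ j → L ≤ j → Σ (Subset n) λ S → ∣ S ∣ ≤ K × (∀ q → G (q , j) → q ∈ S)

  levelBound-initial : ∀ G → LevelBound n G 0
  levelBound-initial _ _ _ = ⊤ , ∣p∣≤n ⊤ , λ _ _ → ∈⊤

  levelBound-zero : ∀ {G L v} → HasSuccessors G → LevelBound 0 G L → ¬ G v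
  levelBound-zero {L = L} {v = q , i} successors bound Gv =
    let (q' , path) = reach-level successors Gv (m≤n⊔m L i)
        (S , ∣S∣≤0 , covers) = bound (L ⊔ i) (m≤m⊔n L i)
    in contradiction (≤-trans (x∈p⇒∣p-x∣<∣p∣ (covers q' (reach-target path))) ∣S∣≤0) λ ()

  levelBound-shrinks : ∀ {G H K L q i} → HasSuccessors G → G (q , i) →
                       (∀ u → H u → G u × ¬ ReachG G (q , i) u) →
                       LevelBound (suc K) G L → LevelBound K H (L ⊔ i)
  levelBound-shrinks {L = L} {q} {i} successors Gq H⊆ bound j L⊔i≤j =
    let (q' , path) = reach-level successors Gq (≤-trans (m≤n⊔m L i) L⊔i≤j)
        (S , ∣S∣≤1+K , covers) = bound j (≤-trans (m≤m⊔n L i) L⊔i≤j)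
    in S - q' , ≤-pred (≤-trans (x∈p⇒∣p-x∣<∣p∣ (covers q' (reach-target path))) ∣S∣≤1+K) ,
       λ q'' Hq'' → let (Gq'' , unreached) = H⊆ _ Hq'' in
                    x∈p∧x≢y⇒x∈p-y (covers q'' Gq'') λ { refl → unreached path }

  choice-shrinks : ∀ {G K L} → HasSuccessors G → EndangeredVertex G → (d : Dec (EndangeredVertex G)) →
                   LevelBound (suc K) G L → Σ ℕ λ L' → LevelBound K (removeFinite (removeReach G (choice d))) L'
  choice-shrinks _          e (no none)               _     = contradiction e none
  choice-shrinks successors _ (yes (_ , _ , Gx , _)) bound =
    _ , levelBound-shrinks successors Gx (λ _ (Hu , _) → proj₁ Hu , λ path → proj₂ Hu (_ , _ , here refl , path)) bound

  module Forward (rejecting : ¬ Accepted) (someMin : Σ (Subset k) IsMin) where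

    lexMin : Subset k
    lexMin = proj₁ (lex-least em IsMin someMin)

    lexMin-lex : IsLex lexMin
    lexMin-lex = let (_ , M-min , least) = lex-least em IsMin someMin in M-min , least

    stage : ℕ → Graph
    η     : ℕ → List (Vertex × Subset k)

    stage zero    = removeFinite Gw
    stage (suc t) = removeFinite (removeReach (stage t) (η t))

    η t = choice (em {EndangeredVertex (stage t)})

    stage-successors : ∀ t → HasSuccessors (stage t)
    stage-successors zero    = removeFinite-successors Gw
    stage-successors (suc t) = removeFinite-successors _

    stage-antitone : ∀ {t t' u} → t ≤′ t' → stage t' u → stage t u
    stage-antitone ≤′-refl         in-t' = in-t'
    stage-antitone (≤′-step t≤′t') in-t' = stage-antitone t≤′t' (proj₁ (proj₁ in-t'))

    stage⇒infinite : ∀ t {u} → stage t u → Gw u × ¬ FiniteIn Gw u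
    stage⇒infinite t = stage-antitone {0} {t} (≤⇒≤′ z≤n)

    Leaves : ℕ → Vertex → Set
    Leaves t u = stage t u × ¬ stage (suc t) u

    leaves-unique : ∀ {t t' u} → Leaves t u → Leaves t' u → t ≡ t'
    leaves-unique {t} {t'} (in-t , gone) (in-t' , gone') with <-cmp t t'
    ... | tri< t<t' _ _ = contradiction (stage-antitone (≤⇒≤′ t<t') in-t') gone
    ... | tri≈ _ t≡t' _ = t≡t'
    ... | tri> _ _ t'<t = contradiction (stage-antitone (≤⇒≤′ t'<t) in-t) gone'

    ReachedAt : ℕ → Vertex → Set
    ReachedAt t u = Σ Vertex λ x → Σ (Subset k) λ M → (x , M) ∈ₗ η t × ReachG (stage t) x u

    reached⇒leaves : ∀ {t u} → ReachedAt t u → Leaves t u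
    reached⇒leaves reached@(_ , _ , _ , path) = reach-target path , λ in-next → proj₂ (proj₁ in-next) reached

    finiteAfter⇒leaves : ∀ {t u} → FiniteIn (removeReach (stage t) (η t)) u → Leaves t u
    finiteAfter⇒leaves {t} finite@((in-t , _) , _) = in-t , λ in-next → proj₂ in-next finite

    twice : ℕ → ℕ
    twice zero    = zero
    twice (suc t) = suc (suc (twice t))

    -- A vertex in no stage was finite in G_w; any other one leaves exactly one stage.
    label : Vertex → ℕ × Subset k
    label u with em {Σ ℕ λ t → Leaves t u}
    ... | no _ = 0 , lexMin
    ... | yes (t , _) with em {ReachedAt t u}
    ...   | yes (_ , M , _) = suc (twice t) , M
    ...   | no _            = twice (suc t) , lexMin

    label-finite : ∀ {u} → FiniteIn Gw u → label u ≡ (0 , lexMin)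
    label-finite {u} finite with em {Σ ℕ λ t → Leaves t u}
    ... | no _              = refl
    ... | yes (t , in-t , _) = contradiction finite (proj₂ (stage⇒infinite t in-t))

    label-reached : ∀ {t x M u} → (x , M) ∈ₗ η t → ReachG (stage t) x u → label u ≡ (suc (twice t) , M)
    label-reached {t} {x} {M} {u} x∈η path with em {Σ ℕ λ t → Leaves t u}
    ... | no never = contradiction (t , reached⇒leaves {t} (x , M , x∈η , path)) never
    ... | yes (t' , leaves) with leaves-unique {t'} {t} leaves (reached⇒leaves {t} (x , M , x∈η , path))
    ...   | refl with em {ReachedAt t u}
    ...     | yes (_ , M' , x'∈η , _) =
      cong (suc (twice t) ,_) (choice-functional (em {EndangeredVertex (stage t)}) x'∈η x∈η)
    ...     | no unreached             = contradiction (x , M , x∈η , path) unreached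

    label-finiteAfter : ∀ {t u} → FiniteIn (removeReach (stage t) (η t)) u → label u ≡ (twice (suc t) , lexMin)
    label-finiteAfter {t} {u} finite with em {Σ ℕ λ t → Leaves t u}
    ... | no never = contradiction (t , finiteAfter⇒leaves {t} finite) never
    ... | yes (t' , leaves) with leaves-unique {t'} {t} leaves (finiteAfter⇒leaves {t} finite)
    ...   | refl with em {ReachedAt t u}
    ...     | yes reached = contradiction reached (proj₂ (proj₁ finite))
    ...     | no _        = refl

    rank : Vertex → ℕ
    rank = proj₁ ∘ label

    mark : Vertex → Subset k
    mark = proj₂ ∘ label

    labelled : ∀ {u r M} → label u ≡ (r , M) → rank u ≡ r × mark u ≡ M
    labelled e = cong proj₁ e , cong proj₂ e

    lex-labelled : ∀ {u r} → label u ≡ (r , lexMin) → rank u ≡ r × IsLex (mark u)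
    lex-labelled e = cong proj₁ e , subst IsLex (sym (cong proj₂ e)) lexMin-lex

    execute : ∀ K t {L} → LevelBound K (stage t) L → Exec rank mark (twice t) (stage t)
    execute K t bound with em {Σ Vertex (stage t)}
    ... | no empty = done λ v in-t → empty (v , in-t)
    execute zero    t bound | yes (_ , in-t) = contradiction in-t (levelBound-zero (stage-successors t) bound)
    execute (suc K) t bound | yes (_ , in-t) =
      step (η t) (choice-endangered found em)
           (λ _ _ _ x∈η path → labelled (label-reached {t} x∈η path))
           (λ _ finite → lex-labelled (label-finiteAfter {t} finite))
           (execute K (suc t) (proj₂ (choice-shrinks (stage-successors t) found em bound)))
      where
        found = ∃-endangered rejecting someMin (stage t) (λ _ → proj₁ ∘ stage⇒infinite t) in-t

    returns : Returns rank mark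
    returns = (λ _ finite → lex-labelled (label-finite finite)) , execute n 0 (levelBound-initial _)

corollary1 : ExcludedMiddle 0ℓ →
    ∀ {n s k} (A : TELA n s k) (h : InfOnly (TELA.Acc A)) (w : ℕ → Fin s) →
    Σ (Subset k) (RunDAG.IsMin A h w) →
    (¬ Lang.Accepted A w) ⇔
      Σ (RunDAG.Vertex A h w → ℕ) λ r → Σ (RunDAG.Vertex A h w → Subset k) λ m →
        RunDAG.Returns A h w r m
corollary1 em A h w someMin = mk⇔
  (λ rejecting → let open Labelling.Forward em A h w rejecting someMin in rank , mark , returns)
  (λ (_ , _ , returns) → Labelling.returns⇒rejecting em A h w returns)
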